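{- Let $n\ge 2$ and let $TBool_n^{\rm Perm}$ be the set of TSSCPP boolean triangles of order $n$ with weakly decreasing rows, partially ordered by reverse componentwise comparison, and identify each such triangle $b$ with the permutation $\Psi(b)$ described below. Then $TBool_n^{\rm Perm}$ contains both $Tam_n$ and $Cat_n$ as subposets. In particular, the induced subposet of $TBool_n^{\rm Perm}$ on the triangles $b$ with $\Psi(b)$ avoiding the pattern $132$ is isomorphic to the Tamari lattice $Tam_n$, and the induced subposet on the triangles $b$ with $\Psi(b)$ avoiding the pattern $213$ is isomorphic to the Catalan distributive lattice $Cat_n$.
   Context: A TSSCPP boolean triangle of order $n$ is an array $\{b_{i,j}\}$ indexed by $1\leq i\leq n-1$, $n-i\leq j\leq n-1$, with entries in $\{0,1\}$, such that for all $j$ and all $i'$ with $j\le i'\le n-1$, $1+\sum_{i=j+1}^{i'} b_{i,n-j-1} \geq \sum_{i=j}^{i'} b_{i,n-j}$ (empty sums are $0$). Rows are weakly decreasing if $b_{i,j}\ge b_{i,j+1}$ whenever both exist. Reverse componentwise comparison: $b\le b'$ iff $b_{i,j}\ge b'_{i,j}$ for all $(i,j)$. The map $\Psi$: define $a_{n,j}=j+1$ for $0\le j\le n-1$ and, for $i=n-1,\dots,1$ and $n-i\le j\le n-1$, set $a_{i,j}=a_{i+1,j}$ if $b_{i,j}=0$ and $a_{i,j}=a_{i+1,j-1}$ if $b_{i,j}=1$; then $\Psi(b)=\sigma$ where $\sigma(i)$ is the unique value in $\{a_{i,j}\}_j$ not in $\{a_{i-1,j}\}_j$ (row $0$ empty).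 This is a bijection onto the permutations of $\{1,\dots,n\}$. A permutation $\sigma$ of $\{1,\dots,n\}$ contains a pattern $\pi$ of length $k$ if there are indices $i_1<\dots<i_k$ such that $\sigma(i_1),\dots,\sigma(i_k)$ are in the same relative order as $\pi(1),\dots,\pi(k)$; otherwise it avoids $\pi$. $Tam_n$: the set of sequences $(x_1,\dots,x_n)$ of positive integers with $i\le x_i\le n$ for all $i$ and such that $i\le j\le x_i$ implies $x_j\le x_i$, ordered by reverse componentwise comparison ($x\le y$ iff $x_i\ge y_i$ for all $i$). $Cat_n$: the set of sequences $(x_1,\dots,x_n)$ of positive integers with $i\le x_i\le n$ for all $i$ and such that $i\le j$ implies $x_i\le x_j$, ordered by reverse componentwise comparison. -}

module Defs where

open import Data.Nat using (ℕ; zero; suc; _+_; _∸_; _≤_; _<_; _≡ᵇ_)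
open import Data.Bool using (Bool; true; false; if_then_else_; not)
open import Data.List using (List; []; _∷_; applyUpTo; filterᵇ)
open import Data.Nat.ListAction using (sum)
open import Data.Bool.ListAction using (any)
open import Data.Fin as Fin using (Fin)
open import Data.Vec using (Vec; []; _∷_; lookup)
open import Data.Product using (Σ; _×_)
import Data.Product as Σ
open import Function.Bundles using (_⇔_)
open import Relation.Nullary using (¬_)
open import Relation.Binary.PropositionalEquality using (_≡_)
open import Data.Maybe using (Maybe; just; nothing)

bit : Bool → ℕ
bit false = 0
bit true  = 1

-- A boolean triangle of order n: its entries b i j are only read on the
-- index domain 1 ≤ i ≤ n-1, n-i ≤ j ≤ n-1 (entries outside are irrelevant;
-- equality of triangles is agreement on the domain, see _≈T_ below).
Tri : Set
Tri = ℕ → ℕ → Bool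

InDom : ℕ → ℕ → ℕ → Set
InDom n i j = (1 ≤ i) × (i ≤ n ∸ 1) × (n ∸ i ≤ j) × (j ≤ n ∸ 1)

-- Σ_{i=a}^{c} f i  (empty, i.e. 0, when c < a)
sumFromTo : (ℕ → ℕ) → ℕ → ℕ → ℕ
sumFromTo f a c = sum (applyUpTo (λ k → f (a + k)) (suc c ∸ a))

IsTSSCPP : ℕ → Tri → Set
IsTSSCPP n b = ∀ j i' → 1 ≤ j → j ≤ i' → i' ≤ n ∸ 1 →
  sumFromTo (λ i → bit (b i (n ∸ j))) j i'
    ≤ 1 + sumFromTo (λ i → bit (b i (n ∸ j ∸ 1))) (suc j) i'

WeakDecRows : ℕ → Tri → Set
WeakDecRows n b = ∀ i j → InDom n i j → InDom n i (suc j) →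
  bit (b i (suc j)) ≤ bit (b i j)

_≤T[_]_ : Tri → ℕ → Tri → Set
b ≤T[ n ] b' = ∀ i j → InDom n i j → bit (b' i j) ≤ bit (b i j)

_≈T[_]_ : Tri → ℕ → Tri → Set
b ≈T[ n ] b' = ∀ i j → InDom n i j → b i j ≡ b' i j

-- aRec n b d j = a_{n-d, j}:  a_{n,j} = j+1, and for i = n-d < n,
-- a_{i,j} = a_{i+1,j} if b_{i,j} = 0, a_{i+1,j-1} if b_{i,j} = 1.
aRec : ℕ → Tri → ℕ → ℕ → ℕ
aRec n b zero    j = suc j
aRec n b (suc d) j = if b (n ∸ suc d) j then aRec n b d (j ∸ 1) else aRec n b d j

aEntry : ℕ → Tri → ℕ → ℕ → ℕ
aEntry n b i j = aRec n b (n ∸ i) j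

aRow : ℕ → Tri → ℕ → List ℕ
aRow n b i = applyUpTo (λ k → aEntry n b i (n ∸ i + k)) i

_∈ᵇ_ : ℕ → List ℕ → Bool
v ∈ᵇ xs = any (v ≡ᵇ_) xs

firstOr0 : List ℕ → ℕ
firstOr0 []      = 0
firstOr0 (x ∷ _) = x

Ψ : ℕ → Tri → ℕ → ℕ
Ψ n b i = firstOr0 (filterᵇ (λ v → not (v ∈ᵇ aRow n b (i ∸ 1))) (aRow n b i))

-- Patterns (permutations σ of {1..n} given as functions on 1..n)

Contains : ℕ → (ℕ → ℕ) → (k : ℕ) → (Fin k → ℕ) → Set
Contains n σ k π = Σ (Fin k → ℕ) λ ι →
  (∀ p → (1 ≤ ι p) × (ι p ≤ n)) ×
  (∀ p q → p Fin.< q → ι p < ι q) ×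
  (∀ p q → (σ (ι p) < σ (ι q)) ⇔ (π p < π q))

Avoids : ℕ → (ℕ → ℕ) → (k : ℕ) → (Fin k → ℕ) → Set
Avoids n σ k π = ¬ Contains n σ k π

π132 : Fin 3 → ℕ
π132 = lookup (1 ∷ 3 ∷ 2 ∷ [])

π213 : Fin 3 → ℕ
π213 = lookup (2 ∷ 1 ∷ 3 ∷ [])

record PosetData : Set₁ where
  field
    Car : Set
    _≈ₚ_ : Car → Car → Set
    _≤ₚ_ : Car → Car → Set

record OrderIso (P Q : PosetData) : Set where
  private
    module P = PosetData P
    module Q = PosetData Q
  field
    to      : P.Car → Q.Car
    from    : Q.Car → P.Car
    to-≤    : ∀ x y → x P.≤ₚ y ⇔ to x Q.≤ₚ to y
    from-≤  : ∀ x y → x Q.≤ₚ y ⇔ from x P.≤ₚ from y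
    from-to : ∀ x → from (to x) P.≈ₚ x
    to-from : ∀ y → to (from y) Q.≈ₚ y

TBoolPermAvoiding : ℕ → (k : ℕ) → (Fin k → ℕ) → PosetData
TBoolPermAvoiding n k π = record
  { Car = Σ Tri (λ b → IsTSSCPP n b × WeakDecRows n b × Avoids n (Ψ n b) k π)
  ; _≈ₚ_ = λ x y → Σ.proj₁ x ≈T[ n ] Σ.proj₁ y
  ; _≤ₚ_ = λ x y → Σ.proj₁ x ≤T[ n ] Σ.proj₁ y
  }

-- Tam_n and Cat_n (sequences x_1..x_n, given as functions read on 1..n)

IsTam : ℕ → (ℕ → ℕ) → Set
IsTam n x = (∀ i → 1 ≤ i → i ≤ n → (i ≤ x i) × (x i ≤ n)) ×
            (∀ i j → 1 ≤ i → i ≤ j → j ≤ x i → x j ≤ x i)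

IsCat : ℕ → (ℕ → ℕ) → Set
IsCat n x = (∀ i → 1 ≤ i → i ≤ n → (i ≤ x i) × (x i ≤ n)) ×
            (∀ i j → 1 ≤ i → i ≤ j → j ≤ n → x i ≤ x j)

_≈S[_]_ : (ℕ → ℕ) → ℕ → (ℕ → ℕ) → Set
x ≈S[ n ] y = ∀ i → 1 ≤ i → i ≤ n → x i ≡ y i

_≤S[_]_ : (ℕ → ℕ) → ℕ → (ℕ → ℕ) → Set
x ≤S[ n ] y = ∀ i → 1 ≤ i → i ≤ n → y i ≤ x i

Tam : ℕ → PosetData
Tam n = record
  { Car = Σ (ℕ → ℕ) (IsTam n)
  ; _≈ₚ_ = λ x y → Σ.proj₁ x ≈S[ n ] Σ.proj₁ y
  ; _≤ₚ_ = λ x y → Σ.proj₁ x ≤S[ n ] Σ.proj₁ y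
  }

Cat : ℕ → PosetData
Cat n = record
  { Car = Σ (ℕ → ℕ) (IsCat n)
  ; _≈ₚ_ = λ x y → Σ.proj₁ x ≈S[ n ] Σ.proj₁ y
  ; _≤ₚ_ = λ x y → Σ.proj₁ x ≤S[ n ] Σ.proj₁ y
  }

module Submission where

-- A triangle b with weakly decreasing rows is determined by its row codes:
-- row i (1 ≤ i ≤ n-1) is 1^(c i) 0^(i - c i) with 0 ≤ c i ≤ i.  The proof
-- rests on three facts about this code c.
--  (1) Triangles with decreasing rows, codes, and sequences x i = i + c (n-i)
--      with i ≤ x i ≤ n correspond bijectively and order-preservingly; such
--      triangles satisfy the TSSCPP inequalities automatically.
--  (2) Ψ(b) is built by insertion: the k-th value is inserted at rank c(k-1)
--      among the first k values.  Hence c k counts the j ≤ k with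
--      σ(j) < σ(k+1), and every rank is attained.
--  (3) With this reading, σ avoids 132 iff c satisfies the "Tamari"
--      condition CondT, and avoids 213 iff c (k+1) ≤ c k + 1 (CondC); on the
--      sequence side these are exactly the defining conditions of Tam_n and
--      Cat_n.
-- For 132, (3) goes through the block property LargerFirst: the entries
-- before position k+1 that are smaller than σ(k+1) are exactly the last c k
-- of them.  For 213, an occurrence can be made adjacent in its last two
-- positions, which CondC rules out.

open import Data.Nat using (ℕ; zero; suc; _+_; _∸_; _≤_; _<_; _≡ᵇ_; _<ᵇ_; _≤ᵇ_; z≤n; s≤s)
open import Data.Nat.Properties
open import Data.Product using (Σ; _×_; _,_; proj₁; proj₂)
open import Data.Sum using (_⊎_; inj₁; inj₂)
open import Data.Empty using (⊥; ⊥-elim)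
open import Relation.Binary.PropositionalEquality
open import Relation.Binary.Definitions using (tri<; tri≈; tri>)
open import Data.Bool using (Bool; true; false; if_then_else_; not; T)
open import Data.Bool.Properties using (∨-zeroʳ)
open import Data.List using (_∷_; applyUpTo; filterᵇ)
open import Relation.Nullary using (¬_; yes; no)
open import Data.Fin as Fin using (Fin)
open import Function using (_∘_)
open import Function.Bundles using (_⇔_; mk⇔; Equivalence)
open import Data.Nat.ListAction using (sum)
open import Defs

<ᵇ-view : ∀ m n → ((m <ᵇ n) ≡ true × m < n) ⊎ ((m <ᵇ n) ≡ false × n ≤ m)
<ᵇ-view m n with m <ᵇ n in eq
... | true  = inj₁ (refl , <ᵇ⇒< m n (subst T (sym eq) _))
... | false = inj₂ (refl , ≮⇒≥ (λ m<n → subst T eq (<⇒<ᵇ m<n)))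

<ᵇ-true : ∀ {m n} → m < n → (m <ᵇ n) ≡ true
<ᵇ-true {m} {n} m<n with <ᵇ-view m n
... | inj₁ (e , _)   = e
... | inj₂ (_ , n≤m) = ⊥-elim (<⇒≱ m<n n≤m)

<ᵇ-false : ∀ {m n} → n ≤ m → (m <ᵇ n) ≡ false
<ᵇ-false {m} {n} n≤m with <ᵇ-view m n
... | inj₁ (_ , m<n) = ⊥-elim (<⇒≱ m<n n≤m)
... | inj₂ (e , _)   = e

<ᵇ-sound : ∀ {m n} → (m <ᵇ n) ≡ true → m < n
<ᵇ-sound {m} {n} e = <ᵇ⇒< m n (subst T (sym e) _)

<ᵇ-false-sound : ∀ {m n} → (m <ᵇ n) ≡ false → n ≤ m
<ᵇ-false-sound {m} {n} e with <ᵇ-view m n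
... | inj₁ (e' , _)  with () ← trans (sym e) e'
... | inj₂ (_ , n≤m) = n≤m

≤ᵇ-true : ∀ {m n} → m ≤ n → (m ≤ᵇ n) ≡ true
≤ᵇ-true {zero}  _ = refl
≤ᵇ-true {suc m} h = <ᵇ-true h

≤ᵇ-false : ∀ {m n} → n < m → (m ≤ᵇ n) ≡ false
≤ᵇ-false {suc m} (s≤s h) = <ᵇ-false h

<ᵇ-+-cancelˡ : ∀ a p q → (a + p <ᵇ a + q) ≡ (p <ᵇ q)
<ᵇ-+-cancelˡ zero    p q = refl
<ᵇ-+-cancelˡ (suc a) p q = <ᵇ-+-cancelˡ a p q

<⇒≤∸1 : ∀ {m n} → m < n → m ≤ n ∸ 1
<⇒≤∸1 {n = suc n} (s≤s h) = h

≤∸1⇒< : ∀ {m n} → 1 ≤ m → m ≤ n ∸ 1 → m < n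
≤∸1⇒< {n = suc n} _ h = s≤s h
≤∸1⇒< {n = zero} m≥1 m≤0 = ⊥-elim (<⇒≱ m≥1 m≤0)

bit≤1 : ∀ x → bit x ≤ 1
bit≤1 false = z≤n
bit≤1 true  = s≤s z≤n

bit-mono : ∀ x y → (x ≡ true → y ≡ true) → bit x ≤ bit y
bit-mono false y h = z≤n
bit-mono true  y h rewrite h refl = ≤-refl

bit-true : ∀ {x} → 1 ≤ bit x → x ≡ true
bit-true {true} _ = refl

-- Inserting a new entry at rank c shifts every rank p ≥ c up by one

shift : ℕ → ℕ → ℕ
shift c p = if p <ᵇ c then p else suc p

shift-view : ∀ c p → (p < c × shift c p ≡ p) ⊎ (c ≤ p × shift c p ≡ suc p)
shift-view c p with <ᵇ-view p c
... | inj₁ (e , lt) rewrite e = inj₁ (lt , refl)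
... | inj₂ (e , ge) rewrite e = inj₂ (ge , refl)

shift-below : ∀ {c p} → p < c → shift c p ≡ p
shift-below h rewrite <ᵇ-true h = refl

shift-above : ∀ {c p} → c ≤ p → shift c p ≡ suc p
shift-above h rewrite <ᵇ-false h = refl

shift-mono : ∀ c {p q} → p < q → shift c p < shift c q
shift-mono c {p} {q} h with shift-view c p | shift-view c q
... | inj₁ (_ , e₁) | inj₁ (_ , e₂) rewrite e₁ | e₂ = h
... | inj₁ (_ , e₁) | inj₂ (_ , e₂) rewrite e₁ | e₂ = m<n⇒m<1+n h
... | inj₂ (c≤p , _) | inj₁ (q<c , _) = ⊥-elim (<-irrefl refl (<-trans (≤-<-trans c≤p h) q<c))
... | inj₂ (_ , e₁) | inj₂ (_ , e₂) rewrite e₁ | e₂ = s≤s h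

shift-≢ : ∀ c p → shift c p ≢ c
shift-≢ c p e with shift-view c p
... | inj₁ (lt , e₁) = <-irrefl (trans (sym e₁) e) lt
... | inj₂ (ge , e₁) = <-irrefl (sym (trans (sym e₁) e)) (s≤s ge)

unshift : ℕ → ℕ → ℕ
unshift c v = if c <ᵇ v then v ∸ 1 else v

shift-<ᵇ : ∀ c u v → (shift c u <ᵇ v) ≡ (u <ᵇ unshift c v)
shift-<ᵇ c u v with <ᵇ-view u c | <ᵇ-view c v
... | inj₁ (e₁ , u<c) | inj₁ (e₂ , c<v) rewrite e₁ | e₂ =
  trans (<ᵇ-true (<-trans u<c c<v)) (sym (<ᵇ-true (<-≤-trans u<c (<⇒≤∸1 c<v))))
... | inj₁ (e₁ , _) | inj₂ (e₂ , _) rewrite e₁ | e₂ = refl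
... | inj₂ (e₁ , c≤u) | inj₁ (e₂ , c<v) rewrite e₁ | e₂ = drop-suc v c<v
  where drop-suc : ∀ v → c < v → (suc u <ᵇ v) ≡ (u <ᵇ (v ∸ 1))
        drop-suc (suc v) _ = refl
... | inj₂ (e₁ , c≤u) | inj₂ (e₂ , v≤c) rewrite e₁ | e₂ =
  trans (<ᵇ-false (≤-trans v≤c (≤-trans c≤u (n≤1+n u)))) (sym (<ᵇ-false (≤-trans v≤c c≤u)))

shift-gap : ∀ c' x y → c' ≤ suc x → shift c' x < y → y < c' → ⊥
shift-gap c' x y c'≤ lt₁ lt₂ with shift-view c' x
... | inj₁ (_ , e) rewrite e = <-irrefl refl (<-≤-trans lt₂ (≤-trans c'≤ lt₁))
... | inj₂ (x≥c' , e) rewrite e = <-irrefl refl (<-trans lt₂ (≤-<-trans x≥c' (<-trans (n<1+n x) lt₁)))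

count : (ℕ → Bool) → ℕ → ℕ → ℕ
count f a zero    = 0
count f a (suc l) = count f a l + bit (f (a + l))

count-+ : ∀ f a l₁ l₂ → count f a (l₁ + l₂) ≡ count f a l₁ + count f (a + l₁) l₂
count-+ f a l₁ zero rewrite +-identityʳ l₁ | +-identityʳ (count f a l₁) = refl
count-+ f a l₁ (suc l₂) rewrite +-suc l₁ l₂ | count-+ f a l₁ l₂ | +-assoc a l₁ l₂ =
  +-assoc (count f a l₁) (count f (a + l₁) l₂) _

count-≤ : ∀ f a l → count f a l ≤ l
count-≤ f a zero    = z≤n
count-≤ f a (suc l) = subst (count f a (suc l) ≤_) (+-comm l 1) (+-mono-≤ (count-≤ f a l) (bit≤1 (f (a + l))))

count-cong : ∀ f g a l → (∀ t → t < l → f (a + t) ≡ g (a + t)) → count f a l ≡ count g a l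
count-cong f g a zero    h = refl
count-cong f g a (suc l) h rewrite count-cong f g a l (λ t lt → h t (m<n⇒m<1+n lt)) | h l ≤-refl = refl

count-mono : ∀ f g a l → (∀ t → t < l → f (a + t) ≡ true → g (a + t) ≡ true) → count f a l ≤ count g a l
count-mono f g a zero    h = z≤n
count-mono f g a (suc l) h = +-mono-≤ (count-mono f g a l (λ t lt → h t (m<n⇒m<1+n lt)))
  (bit-mono (f (a + l)) (g (a + l)) (h l ≤-refl))

count-all : ∀ f a l → (∀ t → t < l → f (a + t) ≡ true) → count f a l ≡ l
count-all f a zero    h = refl
count-all f a (suc l) h rewrite count-all f a l (λ t lt → h t (m<n⇒m<1+n lt)) | h l ≤-refl = +-comm l 1

count-witness : ∀ f a l → 1 ≤ count f a l → Σ ℕ λ t → t < l × f (a + t) ≡ true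
count-witness f a (suc l) h with f (a + l) in eq
... | true  = l , ≤-refl , eq
... | false with count-witness f a l (subst (1 ≤_) (+-identityʳ (count f a l)) h)
... | t , lt , e = t , m<n⇒m<1+n lt , e

count-positive : ∀ f a l t → t < l → f (a + t) ≡ true → 1 ≤ count f a l
count-positive f a (suc l) t h e with m≤n⇒m<n∨m≡n (≤-pred h)
... | inj₁ lt   = ≤-trans (count-positive f a l t lt e) (m≤m+n _ _)
... | inj₂ refl rewrite e = m≤n+m 1 _

count-≤-after-false : ∀ f a o → f a ≡ false → count f a (suc o) ≤ o
count-≤-after-false f a o fa =
  subst (_≤ o) (sym (count-+ f a 1 o))
    (subst (λ z → bit z + count f (a + 1) o ≤ o) (sym (trans (cong f (+-identityʳ a)) fa)) (count-≤ f (a + 1) o))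

-- Given a code c, at step m (m ≥ 1) a new entry is
-- inserted at rank c (m - 1) among the m-1 entries present; pos k m is the
-- rank, after m insertions, of the k-th inserted entry.

module Insertion (c : ℕ → ℕ) where

  -- rank after steps i+1..m of an entry that had rank p after step i
  move : ℕ → ℕ → ℕ → ℕ
  move i zero    p = p
  move i (suc m) p = if i ≤ᵇ m then shift (c m) (move i m p) else p

  move-step : ∀ {i m} p → i ≤ m → move i (suc m) p ≡ shift (c m) (move i m p)
  move-step p h rewrite ≤ᵇ-true h = refl

  move-early : ∀ {i} m p → m ≤ i → move i m p ≡ p
  move-early zero    p h = refl
  move-early {i} (suc m) p h rewrite ≤ᵇ-false {i} {m} h = refl

  move-refl : ∀ i p → move i i p ≡ p
  move-refl i p = move-early i p ≤-refl

  move-∘ : ∀ {i m} m' p → i ≤ m → m ≤ m' → move i m' p ≡ move m m' (move i m p)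
  move-∘ {i} {m} zero p h₁ h₂ with n≤0⇒n≡0 h₂
  ... | refl = sym (move-refl 0 _)
  move-∘ {i} {m} (suc m') p h₁ h₂ with m≤n⇒m<n∨m≡n h₂
  ... | inj₂ refl = sym (move-refl (suc m') _)
  ... | inj₁ (s≤s lt) rewrite move-step p (≤-trans h₁ lt) | move-step (move i m p) lt =
    cong (shift (c m')) (move-∘ m' p h₁ lt)

  move-mono : ∀ i m {p q} → p < q → move i m p < move i m q
  move-mono i zero    h = h
  move-mono i (suc m) h with i ≤ᵇ m
  ... | true  = shift-mono (c m) (move-mono i m h)
  ... | false = h

  move-reflects-< : ∀ i m {p q} → move i m p < move i m q → p < q
  move-reflects-< i m {p} {q} h with <-cmp p q
  ... | tri< p<q _ _ = p<q
  ... | tri≈ _ refl _ = ⊥-elim (<-irrefl refl h)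
  ... | tri> _ _ q<p = ⊥-elim (<-asym h (move-mono i m q<p))

  move-injective : ∀ i m {p q} → move i m p ≡ move i m q → p ≡ q
  move-injective i m {p} {q} h with <-cmp p q
  ... | tri< p<q _ _ = ⊥-elim (<-irrefl h (move-mono i m p<q))
  ... | tri≈ _ e _   = e
  ... | tri> _ _ q<p = ⊥-elim (<-irrefl (sym h) (move-mono i m q<p))

  move-first : ∀ {i m} p → i < m → move i m p ≡ move (suc i) m (shift (c i) p)
  move-first {i} {m} p h rewrite move-∘ {i} {suc i} m p (n≤1+n i) h
    | move-step {i} {i} p ≤-refl | move-refl i p = refl

  pos : ℕ → ℕ → ℕ
  pos k m = move k m (c (k ∸ 1))

  pos-refl : ∀ k → pos k k ≡ c (k ∸ 1)
  pos-refl k = move-refl k _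

  pos-step : ∀ {k m} → k ≤ m → pos k (suc m) ≡ shift (c m) (pos k m)
  pos-step h = move-step _ h

  pos-later : ∀ {k m} m' → k ≤ m → m ≤ m' → pos k m' ≡ move m m' (pos k m)
  pos-later m' h₁ h₂ = move-∘ m' _ h₁ h₂

  pos-<-later : ∀ {a b m} m' → a ≤ m → b ≤ m → m ≤ m' → pos a m < pos b m → pos a m' < pos b m'
  pos-<-later {a} {b} {m} m' ha hb h h' rewrite pos-later {a} m' ha h | pos-later {b} m' hb h = move-mono m m' h'

  pos-<-earlier : ∀ {a b m} m' → a ≤ m → b ≤ m → m ≤ m' → pos a m' < pos b m' → pos a m < pos b m
  pos-<-earlier {a} {b} {m} m' ha hb h h' rewrite pos-later {a} m' ha h | pos-later {b} m' hb h =
    move-reflects-< m m' h'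

  pos-≢-newest : ∀ {a m} → 1 ≤ a → a < m → pos a m ≢ pos m m
  pos-≢-newest {a} {suc m} h₁ (s≤s h₂) e rewrite pos-step {a} h₂ | pos-refl (suc m) = shift-≢ (c m) (pos a m) e

  pos-injective : ∀ {a b m} → 1 ≤ a → a < b → b ≤ m → pos a m ≢ pos b m
  pos-injective {a} {b} {m} h₁ h₂ h₃ e rewrite pos-later {a} m (<⇒≤ h₂) h₃ | pos-later {b} m ≤-refl h₃ =
    pos-≢-newest h₁ h₂ (move-injective b m e)

  -- For a genuine code (c k ≤ k) the ranks after m steps are 0..m-1.
  module Code (c≤ : ∀ k → c k ≤ k) where

    count-below : ∀ m v → v ≤ m → count (λ k → pos k m <ᵇ v) 1 m ≡ v
    count-below zero v h with n≤0⇒n≡0 h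
    ... | refl = refl
    count-below (suc m) v h =
      begin
        count (λ k → pos k (suc m) <ᵇ v) 1 m + bit (pos (suc m) (suc m) <ᵇ v)
      ≡⟨ cong₂ _+_ (count-cong _ _ 1 m (λ t lt → trans (cong (_<ᵇ v) (pos-step {suc t} lt)) (shift-<ᵇ (c m) (pos (suc t) m) v)))
                   (cong (λ z → bit (z <ᵇ v)) (pos-refl (suc m))) ⟩
        count (λ k → pos k m <ᵇ unshift (c m) v) 1 m + bit (c m <ᵇ v)
      ≡⟨ cong (_+ bit (c m <ᵇ v)) (count-below m (unshift (c m) v) unshift≤) ⟩
        unshift (c m) v + bit (c m <ᵇ v)
      ≡⟨ unshift-+ ⟩
        v
      ∎
      where
        open ≡-Reasoning
        unshift≤ : unshift (c m) v ≤ m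
        unshift≤ with <ᵇ-view (c m) v
        ... | inj₁ (e , _)    rewrite e = ∸-monoˡ-≤ 1 h
        ... | inj₂ (e , v≤cm) rewrite e = ≤-trans v≤cm (c≤ m)
        unshift-+ : unshift (c m) v + bit (c m <ᵇ v) ≡ v
        unshift-+ with <ᵇ-view (c m) v
        ... | inj₁ (e , cm<v) rewrite e = m∸n+n≡m (≤-trans (s≤s z≤n) cm<v)
        ... | inj₂ (e , _)    rewrite e = +-identityʳ v

    code-count : ∀ k → count (λ j → pos j (suc k) <ᵇ pos (suc k) (suc k)) 1 k ≡ c k
    code-count k = begin
        count f 1 k
      ≡⟨ sym (+-identityʳ _) ⟩
        count f 1 k + 0
      ≡⟨ cong (λ z → count f 1 k + bit z) (sym (<ᵇ-false {pos (suc k) (suc k)} ≤-refl)) ⟩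
        count f 1 (suc k)
      ≡⟨ cong (λ z → count (λ j → pos j (suc k) <ᵇ z) 1 (suc k)) (pos-refl (suc k)) ⟩
        count (λ j → pos j (suc k) <ᵇ c k) 1 (suc k)
      ≡⟨ count-below (suc k) (c k) (m≤n⇒m≤1+n (c≤ k)) ⟩
        c k
      ∎
      where open ≡-Reasoning
            f = λ j → pos j (suc k) <ᵇ pos (suc k) (suc k)

    pos-surjective : ∀ m v → v < m → Σ ℕ λ k → 1 ≤ k × k ≤ m × pos k m ≡ v
    pos-surjective (suc m) v h with <-cmp v (c m)
    ... | tri≈ _ e _ = suc m , s≤s z≤n , ≤-refl , trans (pos-refl (suc m)) (sym e)
    ... | tri< lt _ _ with pos-surjective m v (<-≤-trans lt (c≤ m))
    ...   | k , h₁ , h₂ , e = k , h₁ , m≤n⇒m≤1+n h₂ , trans (pos-step h₂) (trans (cong (shift (c m)) e) (shift-below lt))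
    pos-surjective (suc m) (suc v) h | tri> _ _ gt with pos-surjective m v (≤-pred h)
    ...   | k , h₁ , h₂ , e = k , h₁ , m≤n⇒m≤1+n h₂ , trans (pos-step h₂) (trans (cong (shift (c m)) e) (shift-above (≤-pred gt)))

lead : (ℕ → Bool) → ℕ → ℕ
lead f zero    = 0
lead f (suc l) = if f 0 then suc (lead (λ p → f (suc p)) l) else 0

lead-≤ : ∀ f l → lead f l ≤ l
lead-≤ f zero = z≤n
lead-≤ f (suc l) with f 0
... | true  = s≤s (lead-≤ _ l)
... | false = z≤n

lead-true : ∀ f l p → p < lead f l → f p ≡ true
lead-true f (suc l) p h with f 0 in eq
lead-true f (suc l) zero    h       | true = eq
lead-true f (suc l) (suc p) (s≤s h) | true = lead-true (λ p → f (suc p)) l p h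

Decreasing : (ℕ → Bool) → ℕ → Set
Decreasing f l = ∀ p → suc p < l → f (suc p) ≡ true → f p ≡ true

decreasing-head : ∀ f l p → Decreasing f l → p < l → f p ≡ true → f 0 ≡ true
decreasing-head f l zero    d h e = e
decreasing-head f l (suc p) d h e = decreasing-head f l p d (<-trans (n<1+n _) h) (d p h e)

lead-false : ∀ f l p → Decreasing f l → lead f l ≤ p → p < l → f p ≡ false
lead-false f (suc l) p d h₁ h₂ with f 0 in eq
... | false with f p in eq₂
...   | false = refl
...   | true with () ← trans (sym eq) (decreasing-head f (suc l) p d h₂ eq₂)
lead-false f (suc l) (suc p) d (s≤s h₁) (s≤s h₂) | true =
  lead-false (λ p → f (suc p)) l p (λ q lt e → d (suc q) (s≤s lt) e) h₁ h₂

lead-exact : ∀ f l L → (∀ p → p < l → f p ≡ (p <ᵇ L)) → L ≤ l → lead f l ≡ L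
lead-exact f zero    L h hL = sym (n≤0⇒n≡0 hL)
lead-exact f (suc l) zero h hL rewrite h 0 (s≤s z≤n) = refl
lead-exact f (suc l) (suc L) h (s≤s hL) rewrite h 0 (s≤s z≤n) =
  cong suc (lead-exact (λ p → f (suc p)) l L (λ p lt → h (suc p) (s≤s lt)) hL)

applyUpTo-cong : ∀ {A : Set} (f g : ℕ → A) l → (∀ t → t < l → f t ≡ g t) → applyUpTo f l ≡ applyUpTo g l
applyUpTo-cong f g zero    h = refl
applyUpTo-cong f g (suc l) h = cong₂ _∷_ (h 0 (s≤s z≤n))
  (applyUpTo-cong (λ t → f (suc t)) (λ t → g (suc t)) l (λ t lt → h (suc t) (s≤s lt)))

≡ᵇ-refl : ∀ m → (m ≡ᵇ m) ≡ true
≡ᵇ-refl zero    = refl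
≡ᵇ-refl (suc m) = ≡ᵇ-refl m

≡ᵇ-false : ∀ {a b} → a ≢ b → (a ≡ᵇ b) ≡ false
≡ᵇ-false {a} {b} ne with a ≡ᵇ b in eq
... | false = refl
... | true  = ⊥-elim (ne (≡ᵇ⇒≡ a b (subst T (sym eq) _)))

∈ᵇ-applyUpTo : ∀ v h l t → t < l → v ≡ h t → (v ∈ᵇ applyUpTo h l) ≡ true
∈ᵇ-applyUpTo v h (suc l) zero lt refl rewrite ≡ᵇ-refl (h 0) = refl
∈ᵇ-applyUpTo v h (suc l) (suc t) (s≤s lt) e
  rewrite ∈ᵇ-applyUpTo v (λ t → h (suc t)) l t lt e = ∨-zeroʳ (v ≡ᵇ h 0)

∉ᵇ-applyUpTo : ∀ v h l → (∀ t → t < l → h t ≢ v) → (v ∈ᵇ applyUpTo h l) ≡ false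
∉ᵇ-applyUpTo v h zero    ne = refl
∉ᵇ-applyUpTo v h (suc l) ne rewrite ≡ᵇ-false (λ e → ne 0 (s≤s z≤n) (sym e))
  = ∉ᵇ-applyUpTo v (λ t → h (suc t)) l (λ t lt → ne (suc t) (s≤s lt))

first-filter : ∀ q g l e → e < l → q (g e) ≡ true → (∀ t → t < e → q (g t) ≡ false) →
  firstOr0 (filterᵇ q (applyUpTo g l)) ≡ g e
first-filter q g (suc l) zero    lt e₁ e₂ rewrite e₁ = refl
first-filter q g (suc l) (suc e) (s≤s lt) e₁ e₂ rewrite e₂ 0 (s≤s z≤n) =
  first-filter q (λ t → g (suc t)) l e lt e₁ (λ t lt' → e₂ (suc t) (s≤s lt'))

-- Rows of a triangle and their codes.  Row i occupies columns n-i .. n-1;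
-- rowF reads it from its first column, code counts its leading ones.

rowF : ℕ → Tri → ℕ → ℕ → Bool
rowF n b i p = b i (n ∸ i + p)

code : ℕ → Tri → ℕ → ℕ
code n b i = lead (rowF n b i) i

code-≤ : ∀ n b i → code n b i ≤ i
code-≤ n b i = lead-≤ _ i

inDom-row : ∀ {n i p} → 1 ≤ i → i < n → p < i → InDom n i (n ∸ i + p)
inDom-row {n} {i} {p} h₁ h₂ h₃ = h₁ , <⇒≤∸1 h₂ , m≤m+n (n ∸ i) p ,
  <⇒≤∸1 (subst (n ∸ i + p <_) (m∸n+n≡m (<⇒≤ h₂)) (+-monoʳ-< (n ∸ i) h₃))

inDom-view : ∀ {n i j} → InDom n i j → (i < n) × Σ ℕ λ p → p < i × j ≡ n ∸ i + p
inDom-view {suc n} {i} {j} (h₁ , h₂ , h₃ , h₄) = i<n , j ∸ (suc n ∸ i) , p<i , sym (m+[n∸m]≡n h₃)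
  where
    i<n = s≤s h₂
    p<i : j ∸ (suc n ∸ i) < i
    p<i = +-cancelˡ-< (suc n ∸ i) _ _
      (subst₂ _<_ (sym (m+[n∸m]≡n h₃)) (sym (m∸n+n≡m (<⇒≤ i<n))) (s≤s h₄))
inDom-view {zero} (h₁ , h₂ , _) = ⊥-elim (<⇒≱ h₁ h₂)

row-decreasing : ∀ n b → WeakDecRows n b → ∀ i → 1 ≤ i → i < n → Decreasing (rowF n b i) i
row-decreasing n b wd i h₁ h₂ p lt e = bit-true (≤-trans (subst (λ z → 1 ≤ bit z) (sym e) ≤-refl)
  (subst (λ z → bit (b i z) ≤ bit (b i (n ∸ i + p))) (sym (+-suc (n ∸ i) p))
    (wd i (n ∸ i + p) (inDom-row h₁ h₂ (<-trans (n<1+n _) lt))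
      (subst (InDom n i) (+-suc (n ∸ i) p) (inDom-row h₁ h₂ lt)))))

row-entry : ∀ n b → WeakDecRows n b → ∀ {i p} → 1 ≤ i → i < n → p < i →
  b i (n ∸ i + p) ≡ (p <ᵇ code n b i)
row-entry n b wd {i} {p} h₁ h₂ h₃ with <ᵇ-view p (code n b i)
... | inj₁ (e , lt) rewrite e = lead-true (rowF n b i) i p lt
... | inj₂ (e , ge) rewrite e = lead-false (rowF n b i) i p (row-decreasing n b wd i h₁ h₂) ge h₃

-- Ψ of a triangle with decreasing rows is the insertion walk of its code:
-- a_{i,j} = 1 + (rank after all n steps of the entry of rank j-(n-i) after
-- step i), so the new value of row k is the k-th inserted entry.

module PsiInsertion (n : ℕ) (b : Tri) (wd : WeakDecRows n b) where
  open Insertion (code n b)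

  aRec-move : ∀ d i p → d + i ≡ n → 1 ≤ i → p < i → aRec n b d (d + p) ≡ suc (move i n p)
  aRec-move zero i p e h₁ h₂ = cong suc (sym (move-early n p (subst (_≤ i) e ≤-refl)))
  aRec-move (suc d) i p e h₁ h₂ =
    trans (cong (λ z → if z then aRec n b d (suc d + p ∸ 1) else aRec n b d (suc d + p)) entry)
          (step (<ᵇ-view p (code n b i)))
    where
      i<n : i < n
      i<n = subst (i <_) e (s≤s (m≤n+m i d))
      row : n ∸ suc d ≡ i
      row = trans (cong (_∸ suc d) (sym e)) (m+n∸m≡n (suc d) i)
      col : n ∸ i ≡ suc d
      col = trans (cong (_∸ i) (sym e)) (m+n∸n≡m (suc d) i)
      entry : b (n ∸ suc d) (suc d + p) ≡ (p <ᵇ code n b i)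
      entry = trans (cong₂ b row (cong (_+ p) (sym col))) (row-entry n b wd h₁ i<n h₂)
      e' : d + suc i ≡ n
      e' = trans (+-suc d i) e
      step : ((p <ᵇ code n b i) ≡ true × p < code n b i) ⊎ ((p <ᵇ code n b i) ≡ false × code n b i ≤ p) →
        (if p <ᵇ code n b i then aRec n b d (suc d + p ∸ 1) else aRec n b d (suc d + p)) ≡ suc (move i n p)
      step (inj₁ (q , lt)) rewrite q | move-first {i} {n} p i<n | shift-below lt =
        aRec-move d (suc i) p e' (s≤s z≤n) (m<n⇒m<1+n h₂)
      step (inj₂ (q , ge)) rewrite q | move-first {i} {n} p i<n | shift-above ge =
        trans (cong (aRec n b d) (sym (+-suc d p))) (aRec-move d (suc i) (suc p) e' (s≤s z≤n) (s≤s h₂))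

  aRow-move : ∀ i → i ≤ n → aRow n b i ≡ applyUpTo (λ t → suc (move i n t)) i
  aRow-move zero    h = refl
  aRow-move (suc i) h = applyUpTo-cong _ _ (suc i) (λ t lt →
    aRec-move (n ∸ suc i) (suc i) t (m∸n+n≡m h) (s≤s z≤n) lt)

  -- the value new in row k is that of the k-th entry, which sits at rank c (k-1)
  Ψ-pos : ∀ k → 1 ≤ k → k ≤ n → Ψ n b k ≡ suc (pos k n)
  Ψ-pos (suc k) h₁ k<n =
    trans (cong₂ (λ A B → firstOr0 (filterᵇ (λ v → not (v ∈ᵇ A)) B)) (aRow-move k (<⇒≤ k<n)) (aRow-move (suc k) k<n))
      (first-filter new g (suc k) C (s≤s (code-≤ n b k)) new-C old-below-C)
    where
      C = code n b k
      g = λ t → suc (move (suc k) n t)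
      new = λ v → not (v ∈ᵇ applyUpTo (λ t → suc (move k n t)) k)
      new-C : new (g C) ≡ true
      new-C rewrite ∉ᵇ-applyUpTo (g C) (λ t → suc (move k n t)) k
        (λ t lt e → shift-≢ C t (move-injective (suc k) n (trans (sym (move-first t k<n)) (suc-injective e)))) = refl
      old-below-C : ∀ t → t < C → new (g t) ≡ false
      old-below-C t lt rewrite ∈ᵇ-applyUpTo (g t) (λ t → suc (move k n t)) k t (<-≤-trans lt (code-≤ n b k))
        (cong suc (trans (cong (move (suc k) n) (sym (shift-below lt))) (sym (move-first t k<n)))) = refl

Pat132 : ℕ → (ℕ → ℕ) → Set
Pat132 n S = Σ ℕ λ p → Σ ℕ λ q → Σ ℕ λ r → 1 ≤ p × p < q × q < r × r ≤ n × S p < S r × S r < S q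

Pat213 : ℕ → (ℕ → ℕ) → Set
Pat213 n S = Σ ℕ λ p → Σ ℕ λ q → Σ ℕ λ r → 1 ≤ p × p < q × q < r × r ≤ n × S q < S p × S p < S r

contains-transport : ∀ n (S S' : ℕ → ℕ) k π →
  (∀ a b → 1 ≤ a → a ≤ n → 1 ≤ b → b ≤ n → S' a < S' b → S a < S b) →
  (∀ a b → 1 ≤ a → a ≤ n → 1 ≤ b → b ≤ n → S a < S b → S' a < S' b) →
  Contains n S k π → Contains n S' k π
contains-transport n S S' k π back forth (ι , bd , inc , iff) = ι , bd , inc , λ p q →
  mk⇔ (λ h → Equivalence.to (iff p q) (back _ _ (proj₁ (bd p)) (proj₂ (bd p)) (proj₁ (bd q)) (proj₂ (bd q)) h))
      (λ h → forth _ _ (proj₁ (bd p)) (proj₂ (bd p)) (proj₁ (bd q)) (proj₂ (bd q)) (Equivalence.from (iff p q) h))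

avoids-suc : ∀ n (S S' : ℕ → ℕ) k π → (∀ a → 1 ≤ a → a ≤ n → S' a ≡ suc (S a)) →
  (Avoids n S k π → Avoids n S' k π) × (Avoids n S' k π → Avoids n S k π)
avoids-suc n S S' k π e =
  (λ av c' → av (contains-transport n S' S k π forth back c')) ,
  (λ av c → av (contains-transport n S S' k π back forth c))
  where
    back : ∀ a b → 1 ≤ a → a ≤ n → 1 ≤ b → b ≤ n → S' a < S' b → S a < S b
    back a b a₁ a₂ b₁ b₂ h rewrite e a a₁ a₂ | e b b₁ b₂ = ≤-pred h
    forth : ∀ a b → 1 ≤ a → a ≤ n → 1 ≤ b → b ≤ n → S a < S b → S' a < S' b
    forth a b a₁ a₂ b₁ b₂ h rewrite e a a₁ a₂ | e b b₁ b₂ = s≤s h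

pattern f0 = Fin.zero
pattern f1 = Fin.suc Fin.zero
pattern f2 = Fin.suc (Fin.suc Fin.zero)

triple : ℕ → ℕ → ℕ → Fin 3 → ℕ
triple p q r f0 = p
triple p q r f1 = q
triple p q r f2 = r

triple-increasing : ∀ {p q r} → p < q → q < r → ∀ a b → a Fin.< b → triple p q r a < triple p q r b
triple-increasing h₁ h₂ f0 f1 _ = h₁
triple-increasing h₁ h₂ f0 f2 _ = <-trans h₁ h₂
triple-increasing h₁ h₂ f1 f2 _ = h₂
triple-increasing h₁ h₂ f1 f0 ()
triple-increasing h₁ h₂ f2 f0 ()
triple-increasing h₁ h₂ f2 f1 (s≤s ())
triple-increasing h₁ h₂ f0 f0 ()
triple-increasing h₁ h₂ f1 f1 (s≤s ())
triple-increasing h₁ h₂ f2 f2 (s≤s (s≤s ()))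

triple-bounds : ∀ {n p q r} → 1 ≤ p → p < q → q < r → r ≤ n → ∀ a → (1 ≤ triple p q r a) × (triple p q r a ≤ n)
triple-bounds h₀ h₁ h₂ h₃ f0 = h₀ , ≤-trans (<⇒≤ h₁) (≤-trans (<⇒≤ h₂) h₃)
triple-bounds h₀ h₁ h₂ h₃ f1 = ≤-trans h₀ (<⇒≤ h₁) , ≤-trans (<⇒≤ h₂) h₃
triple-bounds h₀ h₁ h₂ h₃ f2 = ≤-trans h₀ (≤-trans (<⇒≤ h₁) (<⇒≤ h₂)) , h₃

same-order : (s t : Fin 3 → ℕ) → (∀ a b → t a < t b → s a < s b) → (∀ a b → t a ≡ t b → a ≡ b) →
  ∀ a b → (s a < s b) ⇔ (t a < t b)
same-order s t mono inj a b = mk⇔ reflect (mono a b)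
  where
    reflect : s a < s b → t a < t b
    reflect h with <-cmp (t a) (t b)
    ... | tri< lt _ _ = lt
    ... | tri≈ _ e _  = ⊥-elim (<-irrefl (cong s (inj a b e)) h)
    ... | tri> _ _ gt = ⊥-elim (<-asym h (mono b a gt))

π132-injective : ∀ a b → π132 a ≡ π132 b → a ≡ b
π132-injective f0 f0 _ = refl
π132-injective f1 f1 _ = refl
π132-injective f2 f2 _ = refl
π132-injective f0 f1 ()
π132-injective f0 f2 ()
π132-injective f1 f0 ()
π132-injective f1 f2 ()
π132-injective f2 f0 ()
π132-injective f2 f1 ()

π213-injective : ∀ a b → π213 a ≡ π213 b → a ≡ b
π213-injective f0 f0 _ = refl
π213-injective f1 f1 _ = refl
π213-injective f2 f2 _ = refl
π213-injective f0 f1 ()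
π213-injective f0 f2 ()
π213-injective f1 f0 ()
π213-injective f1 f2 ()
π213-injective f2 f0 ()
π213-injective f2 f1 ()

follows132 : (s : Fin 3 → ℕ) → s f0 < s f2 → s f2 < s f1 → ∀ a b → π132 a < π132 b → s a < s b
follows132 s h₁ h₂ f0 f1 _ = <-trans h₁ h₂
follows132 s h₁ h₂ f0 f2 _ = h₁
follows132 s h₁ h₂ f2 f1 _ = h₂
follows132 s h₁ h₂ f0 f0 (s≤s ())
follows132 s h₁ h₂ f1 f0 (s≤s ())
follows132 s h₁ h₂ f1 f1 (s≤s (s≤s (s≤s ())))
follows132 s h₁ h₂ f1 f2 (s≤s (s≤s ()))
follows132 s h₁ h₂ f2 f0 (s≤s ())
follows132 s h₁ h₂ f2 f2 (s≤s (s≤s ()))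

follows213 : (s : Fin 3 → ℕ) → s f1 < s f0 → s f0 < s f2 → ∀ a b → π213 a < π213 b → s a < s b
follows213 s h₁ h₂ f1 f0 _ = h₁
follows213 s h₁ h₂ f1 f2 _ = <-trans h₁ h₂
follows213 s h₁ h₂ f0 f2 _ = h₂
follows213 s h₁ h₂ f0 f0 (s≤s (s≤s ()))
follows213 s h₁ h₂ f0 f1 (s≤s ())
follows213 s h₁ h₂ f1 f1 (s≤s ())
follows213 s h₁ h₂ f2 f0 (s≤s (s≤s ()))
follows213 s h₁ h₂ f2 f1 (s≤s ())
follows213 s h₁ h₂ f2 f2 (s≤s (s≤s (s≤s ())))

avoids132⇔ : ∀ n S → (Avoids n S 3 π132 → ¬ Pat132 n S) × (¬ Pat132 n S → Avoids n S 3 π132)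
avoids132⇔ n S = (λ av → av ∘ occurrence) , (λ av → av ∘ triple-of)
  where
    occurrence : Pat132 n S → Contains n S 3 π132
    occurrence (p , q , r , h₀ , h₁ , h₂ , h₃ , s₁ , s₂) =
      triple p q r , triple-bounds h₀ h₁ h₂ h₃ , triple-increasing h₁ h₂ ,
      same-order (λ a → S (triple p q r a)) π132 (follows132 (λ a → S (triple p q r a)) s₁ s₂) π132-injective
    triple-of : Contains n S 3 π132 → Pat132 n S
    triple-of (ι , bd , inc , iff) =
      ι f0 , ι f1 , ι f2 , proj₁ (bd f0) , inc f0 f1 (s≤s z≤n) , inc f1 f2 (s≤s (s≤s z≤n)) , proj₂ (bd f2) ,
      Equivalence.from (iff f0 f2) (s≤s (s≤s z≤n)) , Equivalence.from (iff f2 f1) (s≤s (s≤s (s≤s z≤n)))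

avoids213⇔ : ∀ n S → (Avoids n S 3 π213 → ¬ Pat213 n S) × (¬ Pat213 n S → Avoids n S 3 π213)
avoids213⇔ n S = (λ av → av ∘ occurrence) , (λ av → av ∘ triple-of)
  where
    occurrence : Pat213 n S → Contains n S 3 π213
    occurrence (p , q , r , h₀ , h₁ , h₂ , h₃ , s₁ , s₂) =
      triple p q r , triple-bounds h₀ h₁ h₂ h₃ , triple-increasing h₁ h₂ ,
      same-order (λ a → S (triple p q r a)) π213 (follows213 (λ a → S (triple p q r a)) s₁ s₂) π213-injective
    triple-of : Contains n S 3 π213 → Pat213 n S
    triple-of (ι , bd , inc , iff) =
      ι f0 , ι f1 , ι f2 , proj₁ (bd f0) , inc f0 f1 (s≤s z≤n) , inc f1 f2 (s≤s (s≤s z≤n)) , proj₂ (bd f2) ,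
      Equivalence.from (iff f1 f0) (s≤s (s≤s z≤n)) , Equivalence.from (iff f0 f2) (s≤s (s≤s (s≤s z≤n)))

-- A 213 occurrence in an injective sequence can be moved so that its last
-- two positions are adjacent: step q forward while S (q+1) stays below S p.
adjacent-213 : ∀ n (S : ℕ → ℕ) → (∀ a b → 1 ≤ a → a < b → b ≤ n → S a ≢ S b) → Pat213 n S →
  Σ ℕ λ p → Σ ℕ λ q → 1 ≤ p × p < q × suc q ≤ n × S q < S p × S p < S (suc q)
adjacent-213 n S inj (p , q , r , p≥1 , p<q , q<r , r≤n , Sq<Sp , Sp<Sr) with m≤n⇒∃[o]m+o≡n q<r
... | g , refl = walk g q p<q r≤n Sq<Sp Sp<Sr
  where
    walk : ∀ g q → p < q → suc q + g ≤ n → S q < S p → S p < S (suc q + g) →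
      Σ ℕ λ p → Σ ℕ λ q → 1 ≤ p × p < q × suc q ≤ n × S q < S p × S p < S (suc q)
    walk zero q p<q r≤n Sq<Sp Sp<Sr rewrite +-identityʳ q = p , q , p≥1 , p<q , r≤n , Sq<Sp , Sp<Sr
    walk (suc g) q p<q r≤n Sq<Sp Sp<Sr with <-cmp (S (suc q)) (S p)
    ... | tri< lt _ _ = walk g (suc q) (m<n⇒m<1+n p<q) (subst (_≤ n) (+-suc (suc q) g) r≤n) lt
                           (subst (λ z → S p < S z) (+-suc (suc q) g) Sp<Sr)
    ... | tri≈ _ e _  = ⊥-elim (inj p (suc q) p≥1 (m<n⇒m<1+n p<q) (≤-trans (m≤m+n (suc q) (suc g)) r≤n) (sym e))
    ... | tri> _ _ gt = p , q , p≥1 , p<q , ≤-trans (m≤m+n (suc q) (suc g)) r≤n , Sq<Sp , gt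

-- Tamari condition on a code c: whenever the block of c (k'+d) entries below
-- position k'+d+1 covers the d positions after k', it covers everything
-- counted by c k' as well.
CondT : ℕ → (ℕ → ℕ) → Set
CondT n c = ∀ k' d → k' + d < n → d ≤ c (k' + d) → c k' + d ≤ c (k' + d)

CondC : ℕ → (ℕ → ℕ) → Set
CondC n c = ∀ k → suc k < n → c (suc k) ≤ suc (c k)

module CodePatterns (n : ℕ) (c : ℕ → ℕ) (c≤ : ∀ k → c k ≤ k) where
  open Insertion c
  open Code c≤

  σ : ℕ → ℕ
  σ k = pos k n

  below : ℕ → ℕ → Bool
  below r j = pos j r <ᵇ pos r r

  below-sound : ∀ {j r} → j ≤ r → r ≤ n → below r j ≡ true → σ j < σ r
  below-sound j≤r r≤n e = pos-<-later n j≤r ≤-refl r≤n (<ᵇ-sound e)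

  below-complete : ∀ {j r} → j ≤ r → r ≤ n → σ j < σ r → below r j ≡ true
  below-complete j≤r r≤n lt = <ᵇ-true (pos-<-earlier n j≤r ≤-refl r≤n lt)

  above⇒not-below : ∀ {j r} → j ≤ r → r ≤ n → σ r < σ j → below r j ≡ false
  above⇒not-below j≤r r≤n lt = <ᵇ-false (<⇒≤ (pos-<-earlier n ≤-refl j≤r r≤n lt))

  not-below⇒above : ∀ {j r} → 1 ≤ j → j < r → r ≤ n → below r j ≡ false → σ r < σ j
  not-below⇒above j≥1 j<r r≤n e = pos-<-later n ≤-refl (<⇒≤ j<r) r≤n
    (≤∧≢⇒< (<ᵇ-false-sound e) (λ eq → pos-≢-newest j≥1 j<r (sym eq)))

  -- The entries before position k+1 that are smaller than σ (k+1) form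
  -- the final block of length c k; equivalently the larger ones come first.
  LargerFirst : Set
  LargerFirst = ∀ j k → 1 ≤ j → j ≤ k → suc k ≤ n → σ (suc k) < σ j → j ≤ k ∸ c k

  -- If entry j (1 ≤ j ≤ k) is larger than σ (k+1), no earlier entry is smaller.
  avoid132⇒larger-first : ¬ Pat132 n σ → LargerFirst
  avoid132⇒larger-first av (suc j') k _ j≤k r≤n above with m≤n⇒∃[o]m+o≡n j≤k
  ... | o , refl = subst (_≤ k ∸ c k) (m+n∸n≡m (suc j') o) (∸-monoʳ-≤ k ck≤o)
    where
      f = below (suc k)
      none-before : count f 1 j' ≡ 0
      none-before with count f 1 j' in eq
      ... | zero  = refl
      ... | suc _ with count-witness f 1 j' (subst (1 ≤_) (sym eq) (s≤s z≤n))
      ...   | t , t<j' , ft = ⊥-elim (av (suc t , suc j' , suc k , s≤s z≤n , s≤s t<j' ,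
                s≤s (s≤s (m≤m+n j' o)) , r≤n , below-sound (≤-trans t<j' (≤-trans (m≤m+n j' o) (≤-trans (n≤1+n _) (n≤1+n _)))) r≤n ft , above))
      ck≤o : c k ≤ o
      ck≤o = begin
          c k
        ≡⟨ sym (code-count k) ⟩
          count f 1 k
        ≡⟨ cong (count f 1) (sym (+-suc j' o)) ⟩
          count f 1 (j' + suc o)
        ≡⟨ count-+ f 1 j' (suc o) ⟩
          count f 1 j' + count f (suc j') (suc o)
        ≡⟨ cong (_+ count f (suc j') (suc o)) none-before ⟩
          count f (suc j') (suc o)
        ≤⟨ count-≤-after-false f (suc j') o (above⇒not-below (≤-trans j≤k (n≤1+n k)) r≤n above) ⟩
          o
        ∎
        where open ≤-Reasoning

  -- Conversely a 132 occurrence (p, j, k+1) has a smaller entry p before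
  -- the larger entry j, which the block structure forbids.
  larger-first⇒avoid132 : LargerFirst → ¬ Pat132 n σ
  larger-first⇒avoid132 lf (suc p' , j , suc k , _ , p<j , s≤s j≤k , r≤n , σp<σr , σr<σj) =
    <-irrefl (sym none-before) some-before
    where
      f = below (suc k)
      a = k ∸ c k
      a+ck : a + c k ≡ k
      a+ck = m∸n+n≡m (c≤ k)
      j≤a : j ≤ a
      j≤a = lf j k (≤-trans (s≤s z≤n) p<j) j≤k r≤n σr<σj
      late-below : ∀ t → t < c k → f (suc a + t) ≡ true
      late-below t t<ck with f (suc (a + t)) in e
      ... | true  = refl
      ... | false = ⊥-elim (<-irrefl refl (≤-<-trans (m≤m+n a t)
              (lf (suc (a + t)) k (s≤s z≤n) late≤k r≤n (not-below⇒above (s≤s z≤n) (s≤s late≤k) r≤n e))))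
        where late≤k : suc (a + t) ≤ k
              late≤k = subst (suc (a + t) ≤_) a+ck (+-monoʳ-< a t<ck)
      none-before : count f 1 a ≡ 0
      none-before = +-cancelʳ-≡ (c k) (count f 1 a) 0 (begin
          count f 1 a + c k
        ≡⟨ cong (count f 1 a +_) (sym (count-all f (suc a) (c k) late-below)) ⟩
          count f 1 a + count f (suc a) (c k)
        ≡⟨ sym (count-+ f 1 a (c k)) ⟩
          count f 1 (a + c k)
        ≡⟨ cong (count f 1) a+ck ⟩
          count f 1 k
        ≡⟨ code-count k ⟩
          c k
        ∎)
        where open ≡-Reasoning
      some-before : 0 < count f 1 a
      some-before = count-positive f 1 a p' (<-trans (n<1+n p') (<-≤-trans p<j j≤a))
        (below-complete (≤-trans (<⇒≤ p<j) (≤-trans j≤k (n≤1+n k))) r≤n σp<σr)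

  larger-first⇒condT : LargerFirst → CondT n c
  larger-first⇒condT lf k' zero _ _ rewrite +-identityʳ k' | +-identityʳ (c k') = ≤-refl
  larger-first⇒condT lf k' d@(suc _) r≤n d≤ck = begin
      c k' + d
    ≡⟨ cong (_+ d) (sym (code-count k')) ⟩
      count (below q) 1 k' + d
    ≤⟨ +-monoˡ-≤ d (count-mono (below q) f 1 k' below-q⇒below-r) ⟩
      count f 1 k' + d
    ≡⟨ cong (count f 1 k' +_) (sym (count-all f (suc k') d window-below)) ⟩
      count f 1 k' + count f (suc k') d
    ≡⟨ sym (count-+ f 1 k' d) ⟩
      count f 1 (k' + d)
    ≡⟨ code-count (k' + d) ⟩
      c (k' + d)
    ∎
    where
      open ≤-Reasoning
      k = k' + d
      q = suc k'
      f = below (suc k)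
      -- all of positions k'+1 .. k are below σ (k+1), since d ≤ c k
      window-below : ∀ t → t < d → f (suc k' + t) ≡ true
      window-below t t<d with f (suc (k' + t)) in e
      ... | true  = refl
      ... | false = ⊥-elim (<-irrefl refl (≤-<-trans (m≤m+n k' t) (≤-trans early k∸ck≤k')))
        where
          x≤k : suc (k' + t) ≤ k
          x≤k = +-monoʳ-< k' t<d
          early : suc (k' + t) ≤ k ∸ c k
          early = lf (suc (k' + t)) k (s≤s z≤n) x≤k r≤n (not-below⇒above (s≤s z≤n) (s≤s x≤k) r≤n e)
          k∸ck≤k' : k ∸ c k ≤ k'
          k∸ck≤k' = subst (k ∸ c k ≤_) (m+n∸n≡m k' d) (∸-monoʳ-≤ k d≤ck)
      below-q⇒below-r : ∀ t → t < k' → below q (1 + t) ≡ true → f (1 + t) ≡ true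
      below-q⇒below-r t t<k' e = <ᵇ-true {pos (suc t) (suc k)} {pos (suc k) (suc k)} (<-trans
        (pos-<-later (suc k) (s≤s (<⇒≤ t<k')) ≤-refl (s≤s (m≤m+n k' d)) (<ᵇ-sound {pos (suc t) q} {pos q q} e))
        (<ᵇ-sound {pos q (suc k)} {pos (suc k) (suc k)} (subst (λ z → f (suc z) ≡ true) (+-identityʳ k') (window-below 0 (s≤s z≤n)))))

  condT⇒larger-first : CondT n c → LargerFirst
  condT⇒larger-first ct (suc k'') k _ j≤k r≤n above with suc k'' ≤? k ∸ c k
  ... | yes early = early
  ... | no late with m≤n⇒∃[o]m+o≡n j≤k
  ...   | o' , refl = ⊥-elim (<-irrefl refl (<-≤-trans ck<ck''+o ct-bound))
    where
      o = suc o'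
      j = suc k''
      k≡ : k'' + o ≡ k
      k≡ = +-suc k'' o'
      f = below (suc k)
      g = below j
      o≤ck : o ≤ c k
      o≤ck = ∸-cancelʳ-≤ (subst (o ≤_) k≡ (m≤n+m o k''))
        (subst (k ∸ c k ≤_) (sym (trans (cong (_∸ o) (sym k≡)) (m+n∸n≡m k'' o))) (≤-pred (≰⇒> late)))
      ct-bound : c k'' + o ≤ c k
      ct-bound = subst (λ z → c k'' + o ≤ c z) k≡
        (ct k'' o (subst (_< n) (sym k≡) r≤n) (subst (λ z → o ≤ c z) (sym k≡) o≤ck))
      -- an entry below σ (k+1) is also below the larger σ j
      below-r⇒below-j : ∀ t → t < k'' → f (1 + t) ≡ true → g (1 + t) ≡ true
      below-r⇒below-j t t<k'' e = <ᵇ-true (pos-<-earlier (suc k) (s≤s (<⇒≤ t<k'')) ≤-refl (≤-trans j≤k (n≤1+n k))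
        (<-trans (<ᵇ-sound e) (pos-<-earlier n ≤-refl (≤-trans j≤k (n≤1+n k)) r≤n above)))
      ck<ck''+o : c k < c k'' + o
      ck<ck''+o = begin-strict
          c k
        ≡⟨ sym (code-count k) ⟩
          count f 1 k
        ≡⟨ cong (count f 1) (sym k≡) ⟩
          count f 1 (k'' + o)
        ≡⟨ count-+ f 1 k'' o ⟩
          count f 1 k'' + count f j o
        ≤⟨ +-mono-≤ (count-mono f g 1 k'' below-r⇒below-j)
                    (count-≤-after-false f j o' (above⇒not-below (≤-trans j≤k (n≤1+n k)) r≤n above)) ⟩
          count g 1 k'' + o'
        ≡⟨ cong (_+ o') (code-count k'') ⟩
          c k'' + o'
        <⟨ +-monoʳ-< (c k'') (n<1+n o') ⟩
          c k'' + o
        ∎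
        where open ≤-Reasoning

  avoid132⇔condT : (¬ Pat132 n σ → CondT n c) × (CondT n c → ¬ Pat132 n σ)
  avoid132⇔condT = larger-first⇒condT ∘ avoid132⇒larger-first , larger-first⇒avoid132 ∘ condT⇒larger-first

  -- If c (k+1) ≥ c k + 2, the entry of rank c k + 1 at time k+2 sits before
  -- position k+1 and forms a 213 with positions k+1, k+2.
  avoid213⇒condC : ¬ Pat213 n σ → CondC n c
  avoid213⇒condC av k r<n with c (suc k) ≤? suc (c k)
  ... | yes ok   = ok
  ... | no jump with pos-surjective (suc (suc k)) (suc (c k)) (≤-trans (≰⇒> jump) (≤-trans (c≤ (suc k)) (n≤1+n _)))
  ...   | p , p≥1 , p≤r , pos-p =
    ⊥-elim (av (p , suc k , r , p≥1 , p<q , ≤-refl , r<n ,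
      pos-<-later n (n≤1+n _) p≤r r<n (subst₂ _<_ (sym pos-q) (sym pos-p) ≤-refl) ,
      pos-<-later n p≤r ≤-refl r<n (subst₂ _<_ (sym pos-p) (sym (pos-refl r)) big)))
    where
      r = suc (suc k)
      big : suc (suc (c k)) ≤ c (suc k)
      big = ≰⇒> jump
      pos-q : pos (suc k) r ≡ c k
      pos-q = trans (pos-step {suc k} ≤-refl) (trans (cong (shift (c (suc k))) (pos-refl (suc k)))
                (shift-below (<-trans (n<1+n _) big)))
      p<q : p < suc k
      p<q with <-cmp p (suc k)
      ... | tri< lt _ _ = lt
      ... | tri≈ _ refl _ = ⊥-elim (<-irrefl (trans (sym pos-q) pos-p) (n<1+n _))
      ... | tri> _ _ gt with ≤-antisym p≤r gt
      ...   | refl = ⊥-elim (<-irrefl (trans (sym pos-p) (pos-refl r)) big)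

  -- Under CondC no 213 has adjacent last positions q = k+1, k+2: the value
  -- at p would have to be ranked strictly between c k (shifted) and c (k+1).
  condC⇒avoid213 : CondC n c → ¬ Pat213 n σ
  condC⇒avoid213 cc pat with adjacent-213 n σ (λ a b a≥1 a<b b≤n → pos-injective a≥1 a<b b≤n) pat
  ... | p , suc k , p≥1 , p<q , r≤n , σq<σp , σp<σr =
    shift-gap (c (suc k)) (c k) (pos p r) (cc k r≤n)
      (subst (_< pos p r) (trans (pos-step {suc k} ≤-refl) (cong (shift (c (suc k))) (pos-refl (suc k))))
        (pos-<-earlier n (n≤1+n _) p≤r r≤n σq<σp))
      (subst (pos p r <_) (pos-refl r) (pos-<-earlier n p≤r ≤-refl r≤n σp<σr))
    where
      r = suc (suc k)
      p≤r : p ≤ r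
      p≤r = ≤-trans (<⇒≤ p<q) (n≤1+n _)

module PsiPatterns (n : ℕ) (b : Tri) (wd : WeakDecRows n b) where
  open PsiInsertion n b wd using (Ψ-pos)
  open CodePatterns n (code n b) (code-≤ n b)

  private
    shifted : ∀ π → (Avoids n σ 3 π → Avoids n (Ψ n b) 3 π) × (Avoids n (Ψ n b) 3 π → Avoids n σ 3 π)
    shifted π = avoids-suc n σ (Ψ n b) 3 π Ψ-pos

  Ψ-avoids132⇒condT : Avoids n (Ψ n b) 3 π132 → CondT n (code n b)
  Ψ-avoids132⇒condT = proj₁ avoid132⇔condT ∘ proj₁ (avoids132⇔ n σ) ∘ proj₂ (shifted π132)

  condT⇒Ψ-avoids132 : CondT n (code n b) → Avoids n (Ψ n b) 3 π132
  condT⇒Ψ-avoids132 = proj₁ (shifted π132) ∘ proj₂ (avoids132⇔ n σ) ∘ proj₂ avoid132⇔condT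

  Ψ-avoids213⇒condC : Avoids n (Ψ n b) 3 π213 → CondC n (code n b)
  Ψ-avoids213⇒condC = avoid213⇒condC ∘ proj₁ (avoids213⇔ n σ) ∘ proj₂ (shifted π213)

  condC⇒Ψ-avoids213 : CondC n (code n b) → Avoids n (Ψ n b) 3 π213
  condC⇒Ψ-avoids213 = proj₁ (shifted π213) ∘ proj₂ (avoids213⇔ n σ) ∘ condC⇒avoid213

seqOf : ℕ → Tri → ℕ → ℕ
seqOf n b i = i + code n b (n ∸ i)

-- row i of triOf n x has x (n-i) - (n-i) leading ones
triOf : ℕ → (ℕ → ℕ) → Tri
triOf n x i j = j <ᵇ x (n ∸ i)

Bounded : ℕ → (ℕ → ℕ) → Set
Bounded n x = ∀ i → 1 ≤ i → i ≤ n → (i ≤ x i) × (x i ≤ n)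

∸-from-+ : ∀ {a b m} → a + b ≡ m → m ∸ a ≡ b
∸-from-+ {a} {b} refl = m+n∸m≡n a b

complement : ∀ {k n} → k < n → Σ ℕ λ i → 1 ≤ i × k + i ≡ n
complement {k} h with m≤n⇒∃[o]m+o≡n h
... | o , e = suc o , s≤s z≤n , trans (+-suc k o) e

n∸i<n : ∀ {n i} → 1 ≤ i → i ≤ n → n ∸ i < n
n∸i<n {n} h₁ h₂ = ∸-monoʳ-< {n} {_} {0} h₁ h₂

triOf-decreasing : ∀ n x → WeakDecRows n (triOf n x)
triOf-decreasing n x i j _ _ = bit-mono (suc j <ᵇ x (n ∸ i)) (j <ᵇ x (n ∸ i))
  (λ e → <ᵇ-true (<-trans (n<1+n j) (<ᵇ-sound {suc j} {x (n ∸ i)} e)))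

code-triOf : ∀ n x → Bounded n x → ∀ k → k < n → (n ∸ k) + code n (triOf n x) k ≡ x (n ∸ k)
code-triOf n x bnd k h with complement h
... | i , i≥1 , e = subst (λ z → z + code n (triOf n x) k ≡ x z) (sym (∸-from-+ e)) (trans (cong (i +_) lead-L) i+L)
  where
    bi = bnd i i≥1 (subst (i ≤_) e (m≤n+m i k))
    L = x i ∸ i
    i+L : i + L ≡ x i
    i+L = m+[n∸m]≡n (proj₁ bi)
    L≤k : L ≤ k
    L≤k = +-cancelˡ-≤ i L k (subst₂ _≤_ (sym i+L) (trans (sym e) (+-comm k i)) (proj₂ bi))
    lead-L : code n (triOf n x) k ≡ L
    lead-L = lead-exact (rowF n (triOf n x) k) k L (λ p lt →
      trans (cong (λ z → z + p <ᵇ x z) (∸-from-+ e))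
        (trans (cong (i + p <ᵇ_) (sym i+L)) (<ᵇ-+-cancelˡ i p L))) L≤k

triOf-seqOf : ∀ n b → WeakDecRows n b → triOf n (seqOf n b) ≈T[ n ] b
triOf-seqOf n b wd i j hd with inDom-view hd
... | i<n , p , p<i , refl rewrite m∸[m∸n]≡n (<⇒≤ i<n) =
  trans (<ᵇ-+-cancelˡ (n ∸ i) p (code n b i)) (sym (row-entry n b wd (proj₁ hd) i<n p<i))

seqOf-triOf : ∀ n x → Bounded n x → seqOf n (triOf n x) ≈S[ n ] x
seqOf-triOf n x bnd i h₁ h₂ with m≤n⇒m<n∨m≡n h₂
... | inj₂ refl rewrite n∸n≡0 i = trans (+-identityʳ i) (≤-antisym (proj₁ (bnd i h₁ ≤-refl)) (proj₂ (bnd i h₁ ≤-refl)))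
... | inj₁ lt = subst (λ z → z + code n (triOf n x) (n ∸ i) ≡ x z) (m∸[m∸n]≡n h₂)
        (code-triOf n x bnd (n ∸ i) (n∸i<n h₁ h₂))

code-antitone : ∀ n b b' → WeakDecRows n b → WeakDecRows n b' → b ≤T[ n ] b' →
  ∀ k → k < n → code n b' k ≤ code n b k
code-antitone n b b' wd wd' b≤b' zero _ = z≤n
code-antitone n b b' wd wd' b≤b' (suc k) k<n = ≮⇒≥ λ longer →
  let p = code n b (suc k)
      p<k = <-≤-trans longer (code-≤ n b' (suc k))
  in <⇒≱ (s≤s z≤n) (subst₂ (λ u v → bit u ≤ bit v)
       (trans (row-entry n b' wd' (s≤s z≤n) k<n p<k) (<ᵇ-true longer))
       (trans (row-entry n b wd (s≤s z≤n) k<n p<k) (<ᵇ-false {p} ≤-refl))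
       (b≤b' (suc k) _ (inDom-row (s≤s z≤n) k<n p<k)))

≤T⇒≤S : ∀ n b b' → WeakDecRows n b → WeakDecRows n b' → b ≤T[ n ] b' → seqOf n b ≤S[ n ] seqOf n b'
≤T⇒≤S n b b' wd wd' b≤b' i h₁ h₂ = +-monoʳ-≤ i (code-antitone n b b' wd wd' b≤b' (n ∸ i) (n∸i<n h₁ h₂))

≤S⇒≤T : ∀ n b b' → WeakDecRows n b → WeakDecRows n b' → seqOf n b ≤S[ n ] seqOf n b' → b ≤T[ n ] b'
≤S⇒≤T n b b' wd wd' x≤x' i j hd with inDom-view hd
... | i<n , p , p<i , refl rewrite row-entry n b wd (proj₁ hd) i<n p<i | row-entry n b' wd' (proj₁ hd) i<n p<i =
  bit-mono (p <ᵇ code n b' i) (p <ᵇ code n b i) (λ e → <ᵇ-true (<-≤-trans (<ᵇ-sound e) codes))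
  where
    codes : code n b' i ≤ code n b i
    codes = +-cancelˡ-≤ (n ∸ i) _ _
      (subst (λ z → n ∸ i + code n b' z ≤ n ∸ i + code n b z) (m∸[m∸n]≡n (<⇒≤ i<n))
        (x≤x' (n ∸ i) (m<n⇒0<n∸m i<n) (m∸n≤m n i)))

-- Decreasing rows imply the TSSCPP inequalities: termwise, the entry of
-- column n-j in row i is at most that of column n-j-1, and the extra first
-- term on the left is at most the 1 on the right.

sum-mono : ∀ f g m → (∀ k → k < m → f k ≤ g k) → sum (applyUpTo f m) ≤ sum (applyUpTo g m)
sum-mono f g zero    h = z≤n
sum-mono f g (suc m) h = +-mono-≤ (h 0 (s≤s z≤n)) (sum-mono (λ k → f (suc k)) (λ k → g (suc k)) m (λ k lt → h (suc k) (s≤s lt)))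

decreasing⇒TSSCPP : ∀ n b → WeakDecRows n b → IsTSSCPP n b
decreasing⇒TSSCPP n b wd j i' j≥1 j≤i' i'≤ rewrite +-∸-assoc 1 j≤i' =
  +-mono-≤ (bit≤1 _) (sum-mono _ _ (i' ∸ j) termwise)
  where
    j<n : j < n
    j<n = ≤∸1⇒< j≥1 (≤-trans j≤i' i'≤)
    col = n ∸ j ∸ 1
    suc-col : suc col ≡ n ∸ j
    suc-col = trans (+-comm 1 col) (m∸n+n≡m (m<n⇒0<n∸m j<n))
    termwise : ∀ k → k < i' ∸ j → bit (b (j + suc k) (n ∸ j)) ≤ bit (b (suc j + k) col)
    termwise k lt rewrite +-suc j k =
      subst (λ z → bit (b (suc (j + k)) z) ≤ bit (b (suc (j + k)) col)) suc-col (wd (suc (j + k)) col in-col in-suc-col)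
      where
        row≤i' : suc (j + k) ≤ i'
        row≤i' = subst (suc (j + k) ≤_) (m+[n∸m]≡n j≤i') (+-monoʳ-< j lt)
        first-col : n ∸ suc (j + k) ≤ col
        first-col = subst (n ∸ suc (j + k) ≤_) (sym (trans (∸-+-assoc n j 1) (cong (n ∸_) (+-comm j 1))))
          (∸-monoʳ-≤ n (s≤s (m≤m+n j k)))
        in-col : InDom n (suc (j + k)) col
        in-col = s≤s z≤n , ≤-trans row≤i' i'≤ , first-col , ∸-monoˡ-≤ 1 (m∸n≤m n j)
        in-suc-col : InDom n (suc (j + k)) (suc col)
        in-suc-col = s≤s z≤n , ≤-trans row≤i' i'≤ , m≤n⇒m≤1+n first-col ,
          subst (_≤ n ∸ 1) (sym suc-col) (∸-monoʳ-≤ n j≥1)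

-- With j = i + d and k' = n - j we have n - i = k' + d, so
-- "j ≤ x i" reads d ≤ c (k'+d) and "x j ≤ x i" reads c k' + d ≤ c (k'+d).

module SequenceOfCode (n : ℕ) (c : ℕ → ℕ) (c≤ : ∀ k → c k ≤ k) (c0 : c 0 ≡ 0) where

  x : ℕ → ℕ
  x i = i + c (n ∸ i)

  bounded : Bounded n x
  bounded i _ i≤n = m≤m+n i _ , subst (x i ≤_) (m+[n∸m]≡n i≤n) (+-monoʳ-≤ i (c≤ (n ∸ i)))

  x-last : ∀ i → n ≤ i → x i ≡ i
  x-last i h rewrite m≤n⇒m∸n≡0 h | c0 = +-identityʳ i

  tam-step : CondT n c → ∀ i d k' → 1 ≤ i → (i + d) + k' ≡ n → i + d ≤ x i → x (i + d) ≤ x i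
  tam-step ct i d k' i≥1 e j≤xi = subst₂ (λ u v → (i + d) + c u ≤ i + c v) (sym n∸j) (sym n∸i) shifted
    where
      n∸i : n ∸ i ≡ d + k'
      n∸i = ∸-from-+ {i} (trans (sym (+-assoc i d k')) e)
      n∸j : n ∸ (i + d) ≡ k'
      n∸j = ∸-from-+ e
      i≤n : i ≤ n
      i≤n = subst (i ≤_) e (≤-trans (m≤m+n i d) (m≤m+n (i + d) k'))
      d≤c : d ≤ c (k' + d)
      d≤c = subst (λ z → d ≤ c z) (+-comm d k') (+-cancelˡ-≤ i _ _ (subst (λ z → i + d ≤ i + c z) n∸i j≤xi))
      k'+d<n : k' + d < n
      k'+d<n = subst (_< n) (+-comm d k') (subst (_< n) n∸i (n∸i<n i≥1 i≤n))
      shifted : (i + d) + c k' ≤ i + c (d + k')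
      shifted = begin
          (i + d) + c k'
        ≡⟨ +-assoc i d (c k') ⟩
          i + (d + c k')
        ≡⟨ cong (i +_) (+-comm d (c k')) ⟩
          i + (c k' + d)
        ≤⟨ +-monoʳ-≤ i (ct k' d k'+d<n d≤c) ⟩
          i + c (k' + d)
        ≡⟨ cong (λ z → i + c z) (+-comm k' d) ⟩
          i + c (d + k')
        ∎
        where open ≤-Reasoning

  -- CondT makes x a Tamari sequence; for i ≥ n the condition is vacuous since x i = i
  condT⇒tam : CondT n c → IsTam n x
  condT⇒tam ct = bounded , nested
    where
      nested : ∀ i j → 1 ≤ i → i ≤ j → j ≤ x i → x j ≤ x i
      nested i j i≥1 i≤j j≤xi with <-cmp i n
      ... | tri< i<n _ _ with m≤n⇒∃[o]m+o≡n i≤j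
      ...   | d , refl with m≤n⇒∃[o]m+o≡n (≤-trans j≤xi (proj₂ (bounded i i≥1 (<⇒≤ i<n))))
      ...     | k' , e = tam-step ct i d k' i≥1 e j≤xi
      nested i j i≥1 i≤j j≤xi | tri≈ _ refl _ rewrite ≤-antisym (≤-trans j≤xi (≤-reflexive (x-last i ≤-refl))) i≤j = ≤-refl
      nested i j i≥1 i≤j j≤xi | tri> _ _ i>n rewrite ≤-antisym (≤-trans j≤xi (≤-reflexive (x-last i (<⇒≤ i>n)))) i≤j = ≤-refl

  condC-iterated : CondC n c → ∀ k' d → k' + d < n → c (k' + d) ≤ c k' + d
  condC-iterated cc k' zero h rewrite +-identityʳ k' | +-identityʳ (c k') = ≤-refl
  condC-iterated cc k' (suc d) h rewrite +-suc k' d | +-suc (c k') d =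
    ≤-trans (cc (k' + d) h) (s≤s (condC-iterated cc k' d (<-trans (n<1+n _) h)))

  condC⇒cat : CondC n c → IsCat n x
  condC⇒cat cc = bounded , increasing
    where
      increasing : ∀ i j → 1 ≤ i → i ≤ j → j ≤ n → x i ≤ x j
      increasing i j i≥1 i≤j j≤n with m≤n⇒∃[o]m+o≡n i≤j
      ... | d , refl with m≤n⇒∃[o]m+o≡n j≤n
      ...   | k' , e = subst₂ (λ u v → i + c v ≤ (i + d) + c u) (sym (∸-from-+ e)) (sym n∸i) (begin
          i + c (d + k')
        ≡⟨ cong (λ z → i + c z) (+-comm d k') ⟩
          i + c (k' + d)
        ≤⟨ +-monoʳ-≤ i (condC-iterated cc k' d k'+d<n) ⟩
          i + (c k' + d)
        ≡⟨ cong (i +_) (+-comm (c k') d) ⟩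
          i + (d + c k')
        ≡⟨ sym (+-assoc i d (c k')) ⟩
          (i + d) + c k'
        ∎)
        where
          open ≤-Reasoning
          n∸i : n ∸ i ≡ d + k'
          n∸i = ∸-from-+ {i} (trans (sym (+-assoc i d k')) e)
          k'+d<n : k' + d < n
          k'+d<n = subst (_< n) (+-comm d k') (subst (_< n) n∸i
            (n∸i<n i≥1 (subst (i ≤_) e (≤-trans (m≤m+n i d) (m≤m+n (i + d) k')))))

tam⇒condT : ∀ n x → IsTam n x → CondT n (code n (triOf n x))
tam⇒condT n x (bnd , nested) k' d k<n d≤ck with complement k<n
... | i , i≥1 , e = +-cancelˡ-≤ i _ _ (subst (_≤ i + c (k' + d)) regroup (subst₂ _≤_ (sym xj) (sym xi) tam))
  where
    c = code n (triOf n x)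
    xi : i + c (k' + d) ≡ x i
    xi = subst (λ z → z + c (k' + d) ≡ x z) (∸-from-+ e) (code-triOf n x bnd (k' + d) k<n)
    e' : k' + (i + d) ≡ n
    e' = trans (cong (k' +_) (+-comm i d)) (trans (sym (+-assoc k' d i)) e)
    xj : (i + d) + c k' ≡ x (i + d)
    xj = subst (λ z → z + c k' ≡ x z) (∸-from-+ {k'} e') (code-triOf n x bnd k' (≤-<-trans (m≤m+n k' d) k<n))
    tam : x (i + d) ≤ x i
    tam = nested i (i + d) i≥1 (m≤m+n i d) (subst (i + d ≤_) xi (+-monoʳ-≤ i d≤ck))
    regroup : (i + d) + c k' ≡ i + (c k' + d)
    regroup = trans (+-assoc i d (c k')) (cong (i +_) (+-comm d (c k')))

-- x i ≤ x (i+1) is c (k+1) ≤ c k + 1 for k = n-i-1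
cat⇒condC : ∀ n x → IsCat n x → CondC n (code n (triOf n x))
cat⇒condC n x (bnd , increasing) k k<n with complement k<n
... | i , i≥1 , e = +-cancelˡ-≤ i _ _ (subst (i + c (suc k) ≤_) (sym (+-suc i (c k))) (subst₂ _≤_ (sym xi) (sym xi+1) cat))
  where
    c = code n (triOf n x)
    xi : i + c (suc k) ≡ x i
    xi = subst (λ z → z + c (suc k) ≡ x z) (∸-from-+ e) (code-triOf n x bnd (suc k) k<n)
    e' : k + suc i ≡ n
    e' = trans (+-suc k i) e
    xi+1 : suc i + c k ≡ x (suc i)
    xi+1 = subst (λ z → z + c k ≡ x z) (∸-from-+ e') (code-triOf n x bnd k (<-trans (n<1+n k) k<n))
    cat : x i ≤ x (suc i)
    cat = increasing i (suc i) i≥1 (n≤1+n i) (subst (suc i ≤_) e' (m≤n+m (suc i) k))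

-- The order isomorphism, generically: whenever a class X of bounded
-- sequences matches the avoidance class π under seqOf / triOf, the
-- π-avoiding part of TBool_n^Perm is order isomorphic to X.

module SequenceIso (n k : ℕ) (π : Fin k → ℕ) (X : (ℕ → ℕ) → Set) (bounded : ∀ x → X x → Bounded n x)
  (seqOf-in : ∀ b → WeakDecRows n b → Avoids n (Ψ n b) k π → X (seqOf n b))
  (triOf-avoids : ∀ x → X x → Avoids n (Ψ n (triOf n x)) k π) where

  Seq : PosetData
  Seq = record { Car = Σ (ℕ → ℕ) X ; _≈ₚ_ = λ x y → proj₁ x ≈S[ n ] proj₁ y ; _≤ₚ_ = λ x y → proj₁ x ≤S[ n ] proj₁ y }

  iso : OrderIso (TBoolPermAvoiding n k π) Seq
  iso = record
    { to      = λ (b , _ , wd , av) → seqOf n b , seqOf-in b wd av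
    ; from    = λ (x , hx) → triOf n x , decreasing⇒TSSCPP n (triOf n x) (triOf-decreasing n x) ,
                               triOf-decreasing n x , triOf-avoids x hx
    ; to-≤    = λ (b , _ , wd , _) (b' , _ , wd' , _) → mk⇔ (≤T⇒≤S n b b' wd wd') (≤S⇒≤T n b b' wd wd')
    ; from-≤  = λ (x , hx) (x' , hx') → mk⇔
        (λ x≤x' → ≤S⇒≤T n (triOf n x) (triOf n x') (triOf-decreasing n x) (triOf-decreasing n x')
          (λ i h₁ h₂ → subst₂ _≤_ (sym (seqOf-triOf n x' (bounded x' hx') i h₁ h₂)) (sym (seqOf-triOf n x (bounded x hx) i h₁ h₂))
            (x≤x' i h₁ h₂)))
        (λ b≤b' i h₁ h₂ → subst₂ _≤_ (seqOf-triOf n x' (bounded x' hx') i h₁ h₂) (seqOf-triOf n x (bounded x hx) i h₁ h₂)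
          (≤T⇒≤S n (triOf n x) (triOf n x') (triOf-decreasing n x) (triOf-decreasing n x') b≤b' i h₁ h₂))
    ; from-to = λ (b , _ , wd , _) → triOf-seqOf n b wd
    ; to-from = λ (x , hx) → seqOf-triOf n x (bounded x hx)
    }

corollary4p20 : ∀ n → 2 ≤ n →
    OrderIso (TBoolPermAvoiding n 3 π132) (Tam n) ×
    OrderIso (TBoolPermAvoiding n 3 π213) (Cat n)
corollary4p20 n _ =
  SequenceIso.iso n 3 π132 (IsTam n) (λ _ → proj₁)
    (λ b wd av → SequenceOfCode.condT⇒tam n (code n b) (code-≤ n b) refl (PsiPatterns.Ψ-avoids132⇒condT n b wd av))
    (λ x tam → PsiPatterns.condT⇒Ψ-avoids132 n (triOf n x) (triOf-decreasing n x) (tam⇒condT n x tam)) ,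
  SequenceIso.iso n 3 π213 (IsCat n) (λ _ → proj₁)
    (λ b wd av → SequenceOfCode.condC⇒cat n (code n b) (code-≤ n b) refl (PsiPatterns.Ψ-avoids213⇒condC n b wd av))
    (λ x cat → PsiPatterns.condC⇒Ψ-avoids213 n (triOf n x) (triOf-decreasing n x) (cat⇒condC n x cat))
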